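{- Let $(G,i)$ be a rooted graph such that $i$ is not an isolated vertex of $G$. Then $(G,i)$ allows the nullity pair $(0,1)$ with the SNIP.
   Context: All matrices are real. For a simple graph $G$ on $[n]$, $\mathcal{S}(G)$ is the set of real symmetric $n\times n$ matrices whose off-diagonal $(j,k)$ entry is nonzero iff $\{j,k\}\in E(G)$ (diagonal free). $A(i)$ is $A$ with row and column $i$ deleted. $A$ has the $i$-SNIP if $X=O$ is the only real symmetric $X$ with $A\circ X=O$, $I\circ X=O$ and $(AX)(i,:]=O$ ($AX$ with row $i$ deleted). A rooted graph $(G,i)$ allows $(k,\ell)$ with the SNIP if some $A\in\mathcal{S}(G)$ with the $i$-SNIP has $(\operatorname{null}(A),\operatorname{null}(A(i)))=(k,\ell)$. -}

module Defs where

open import Level using (0ℓ)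
open import Data.Nat using (ℕ; suc)
open import Data.Fin using (Fin; zero; suc; punchIn)
open import Data.Bool using (Bool; true; false)
open import Data.Product using (Σ; ∃; _×_; _,_)
open import Relation.Nullary using (¬_)
open import Relation.Binary.PropositionalEquality using (_≡_)
open import Relation.Binary.Structures using (IsDecTotalOrder)
open import Algebra.Structures using (IsCommutativeRing)
open import Function.Bundles using (_⇔_)

-- The real numbers, axiomatised as a (Dedekind-)complete ordered field.
-- The theorem is quantified over every such structure (all are
-- isomorphic to ℝ), since agda-stdlib has no real numbers.

record RealField : Set₁ where
  infixl 6 _+_
  infixl 7 _*_
  infix  4 _≤_
  field
    R      : Set
    0r 1r  : R
    _+_ _*_ : R → R → R
    -_     : R → R
    _≤_    : R → R → Set
    isCommutativeRing : IsCommutativeRing _≡_ _+_ _*_ -_ 0r 1r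
    0≢1    : ¬ (0r ≡ 1r)
    inverse : ∀ x → ¬ (x ≡ 0r) → ∃ λ y → x * y ≡ 1r
    isDecTotalOrder : IsDecTotalOrder _≡_ _≤_
    +-mono-≤ : ∀ x y z → x ≤ y → x + z ≤ y + z
    *-pos    : ∀ x y → 0r ≤ x → 0r ≤ y → 0r ≤ x * y
    complete : (P : R → Set) → (∃ λ x → P x) →
               (∃ λ b → ∀ x → P x → x ≤ b) →
               ∃ λ s → (∀ x → P x → x ≤ s) ×
                       (∀ b → (∀ x → P x → x ≤ b) → s ≤ b)

record Graph (n : ℕ) : Set where
  field
    adj     : Fin n → Fin n → Bool
    adj-sym : ∀ j k → adj j k ≡ adj k j
    irrefl  : ∀ j → adj j j ≡ false

open Graph public

NotIsolated : ∀ {n} → Graph n → Fin n → Set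
NotIsolated G i = ∃ λ j → adj G i j ≡ true

module _ (ℝ : RealField) where
  open RealField ℝ

  Vector : ℕ → Set
  Vector n = Fin n → R

  Matrix : ℕ → Set
  Matrix n = Fin n → Fin n → R

  ∑ : ∀ {n} → (Fin n → R) → R
  ∑ {ℕ.zero} f = 0r
  ∑ {suc n} f = f zero + ∑ (λ j → f (suc j))

  _·_ : ∀ {n} → Matrix n → Matrix n → Matrix n
  (A · B) j k = ∑ (λ t → A j t * B t k)

  _⊛_ : ∀ {n} → Matrix n → Vector n → Vector n
  (A ⊛ v) j = ∑ (λ t → A j t * v t)

  Symmetric : ∀ {n} → Matrix n → Set
  Symmetric A = ∀ j k → A j k ≡ A k j

  InS : ∀ {n} → Graph n → Matrix n → Set
  InS G A = Symmetric A ×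
            (∀ j k → ¬ (j ≡ k) → ((¬ (A j k ≡ 0r)) ⇔ (adj G j k ≡ true)))

  deleteRC : ∀ {m} → Matrix (suc m) → Fin (suc m) → Matrix m
  deleteRC A i j k = A (punchIn i j) (punchIn i k)

  InKernel : ∀ {n} → Matrix n → Vector n → Set
  InKernel A v = ∀ j → (A ⊛ v) j ≡ 0r

  LinIndep : ∀ {n k} → (Fin k → Vector n) → Set
  LinIndep {n} {k} vs =
    ∀ (c : Fin k → R) → (∀ t → ∑ (λ j → c j * vs j t) ≡ 0r) → ∀ j → c j ≡ 0r

  HasIndepKernel : ∀ {n} → Matrix n → ℕ → Set
  HasIndepKernel {n} A k =
    Σ (Fin k → Vector n) λ vs → (∀ j → InKernel A (vs j)) × LinIndep vs

  Nullity : ∀ {n} → Matrix n → ℕ → Set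
  Nullity A k = HasIndepKernel A k × ¬ HasIndepKernel A (suc k)

  SNIP-at : ∀ {n} → Matrix n → Fin n → Set
  SNIP-at {n} A i =
    ∀ (X : Matrix n) → Symmetric X →
      (∀ j k → A j k * X j k ≡ 0r) →
      (∀ j → X j j ≡ 0r) →
      (∀ j k → ¬ (j ≡ i) → (A · X) j k ≡ 0r) →
      ∀ j k → X j k ≡ 0r

  AllowsSNIP : ∀ {m} → Graph (suc m) → Fin (suc m) → ℕ → ℕ → Set
  AllowsSNIP G i k ℓ =
    Σ (Matrix _) λ A → InS G A × SNIP-at A i ×
      Nullity A k × Nullity (deleteRC A i) ℓ

module Submission where

-- A nonsingular A ∈ 𝒮(G) has the i-SNIP: if AX vanishes off row i then injectivity makes the
-- columns of X proportional, and symmetry with a zero diagonal forces X = O. Every graph has a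
-- nonsingular realisation, built one vertex at a time by bordering with a nonzero Schur complement.
-- For the pair (0,1), let j be a neighbour of i and C a nonsingular realisation of G − i − j. Bordering
-- C by the neighbours b of j with corner ⟨ b , C⁻¹ b ⟩ makes the Schur complement vanish, giving
-- B = A(i) with kernel spanned by u = (1, −C⁻¹ b). Bordering B by the neighbours a of i, the weight
-- α on the edge ij is free, and any α ≠ 0 with ⟨ u , a ⟩ ≠ 0 makes A nonsingular.

open import Defs hiding (∑; _⊛_)
open import Level using (0ℓ)
open import Data.Nat as ℕ using (ℕ; zero; suc)
import Data.Nat.Properties as ℕ
open import Data.Integer as ℤ using (ℤ; -[1+_]; _⊖_)
import Data.Integer.Properties as ℤ
open import Data.Sign as Sign using ()
open import Data.Maybe using (Maybe; just; nothing)
open import Data.Fin using (Fin; zero; suc; punchIn; punchOut)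
open import Data.Fin.Properties using (all?; ¬∀⟶∃¬; punchInᵢ≢i; punchIn-punchOut)
import Data.Fin.Properties as Fin
open import Data.Bool using (Bool; true; false)
open import Data.Product using (∃; _,_; proj₁; proj₂)
open import Data.Sum using (inj₁; inj₂)
open import Data.Empty using (⊥-elim)
open import Data.Vec.Functional using (insertAt)
open import Data.Vec.Functional.Properties using (insertAt-lookup; insertAt-punchIn)
open import Function.Base using (_∘_)
open import Function.Bundles using (_⇔_; mk⇔)
open import Relation.Nullary using (¬_; Dec; yes; no)
open import Relation.Binary.PropositionalEquality as ≡
  using (_≡_; _≗_; refl; sym; trans; cong; cong₂; cong-app; subst; subst₂; module ≡-Reasoning)
open import Relation.Binary.Structures using (IsDecTotalOrder)
open import Algebra.Bundles using (CommutativeRing)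

-- The ring solver for an arbitrary commutative ring, with integer coefficients: these compare
-- by computation, which equality on an abstract carrier does not.
module IntegerCoefficientRingSolver {c ℓ} (R : CommutativeRing c ℓ) where
  open CommutativeRing R renaming (refl to ≈-refl; sym to ≈-sym; trans to ≈-trans)
  -- The optimised n × x has 0 × x = 0# and 1 × x = x definitionally, so the constants 0 and 1
  -- of a solved equation denote 0# and 1# themselves.
  open import Algebra.Properties.Semiring.Mult.TCOptimised semiring using (_×_; 1+×; ×-homo-+; ×1-homo-*)
  open import Algebra.Properties.Ring ring using (-‿distribˡ-*; -‿distribʳ-*)
  open import Algebra.Properties.AbelianGroup +-abelianGroup using (⁻¹-∙-comm; xyx⁻¹≈y)
  open import Algebra.Properties.Group +-group using (ε⁻¹≈ε; ⁻¹-involutive)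
  open import Algebra.Solver.Ring.AlmostCommutativeRing
    using (fromCommutativeRing; _-Raw-AlmostCommutative⟶_)
  open import Relation.Binary.Reasoning.Setoid (CommutativeRing.setoid R)

  fromℤ : ℤ → Carrier
  fromℤ (ℤ.+ n)  = n × 1#
  fromℤ -[1+ n ] = - (suc n × 1#)

  fromℤ-⊖ : ∀ m n → fromℤ (m ⊖ n) ≈ m × 1# + - (n × 1#)
  fromℤ-⊖ zero    zero    = ≈-sym (-‿inverseʳ 0#)
  fromℤ-⊖ zero    (suc n) = ≈-sym (+-identityˡ _)
  fromℤ-⊖ (suc m) zero    = begin
    suc m × 1#                          ≈⟨ +-identityʳ _ ⟨
    suc m × 1# + 0#                     ≈⟨ +-congˡ ε⁻¹≈ε ⟨
    suc m × 1# + - 0#                   ∎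
  fromℤ-⊖ (suc m) (suc n) = begin
    fromℤ (suc m ⊖ suc n)               ≡⟨ ≡.cong fromℤ (ℤ.[1+m]⊖[1+n]≡m⊖n m n) ⟩
    fromℤ (m ⊖ n)                       ≈⟨ fromℤ-⊖ m n ⟩
    m × 1# + - (n × 1#)                 ≈⟨ +-congʳ (xyx⁻¹≈y 1# (m × 1#)) ⟨
    (1# + m × 1#) + - 1# + - (n × 1#)   ≈⟨ +-assoc _ _ _ ⟩
    (1# + m × 1#) + (- 1# + - (n × 1#)) ≈⟨ +-congˡ (⁻¹-∙-comm 1# (n × 1#)) ⟩
    (1# + m × 1#) + - (1# + n × 1#)     ≈⟨ +-cong (1+× m 1#) (-‿cong (1+× n 1#)) ⟨
    suc m × 1# + - (suc n × 1#)         ∎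

  fromℤ-+ : ∀ i j → fromℤ (i ℤ.+ j) ≈ fromℤ i + fromℤ j
  fromℤ-+ -[1+ m ] -[1+ n ] = begin
    - (suc (suc (m ℕ.+ n)) × 1#)        ≡⟨ ≡.cong (λ k → - (suc k × 1#)) (ℕ.+-suc m n) ⟨
    - ((suc m ℕ.+ suc n) × 1#)          ≈⟨ -‿cong (×-homo-+ 1# (suc m) (suc n)) ⟩
    - (suc m × 1# + suc n × 1#)         ≈⟨ ⁻¹-∙-comm _ _ ⟨
    - (suc m × 1#) + - (suc n × 1#)     ∎
  fromℤ-+ -[1+ m ] (ℤ.+ n)  = ≈-trans (fromℤ-⊖ n (suc m)) (+-comm _ _)
  fromℤ-+ (ℤ.+ m)  -[1+ n ] = fromℤ-⊖ m (suc n)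
  fromℤ-+ (ℤ.+ m)  (ℤ.+ n)  = ×-homo-+ 1# m n

  fromℤ-[-◃] : ∀ n → fromℤ (Sign.- ℤ.◃ n) ≈ - (n × 1#)
  fromℤ-[-◃] zero    = ≈-sym ε⁻¹≈ε
  fromℤ-[-◃] (suc n) = ≈-refl

  fromℤ-* : ∀ i j → fromℤ (i ℤ.* j) ≈ fromℤ i * fromℤ j
  fromℤ-* -[1+ m ] -[1+ n ] = begin
    (suc m ℕ.* suc n) × 1#              ≈⟨ ×1-homo-* (suc m) (suc n) ⟩
    suc m × 1# * suc n × 1#             ≈⟨ ⁻¹-involutive _ ⟨
    - - (suc m × 1# * suc n × 1#)       ≈⟨ -‿cong (-‿distribˡ-* _ _) ⟩
    - (- (suc m × 1#) * suc n × 1#)     ≈⟨ -‿distribʳ-* _ _ ⟩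
    - (suc m × 1#) * - (suc n × 1#)     ∎
  fromℤ-* -[1+ m ] (ℤ.+ n)  = begin
    fromℤ (Sign.- ℤ.◃ (suc m ℕ.* n))    ≈⟨ fromℤ-[-◃] (suc m ℕ.* n) ⟩
    - ((suc m ℕ.* n) × 1#)              ≈⟨ -‿cong (×1-homo-* (suc m) n) ⟩
    - (suc m × 1# * n × 1#)             ≈⟨ -‿distribˡ-* _ _ ⟩
    - (suc m × 1#) * n × 1#             ∎
  fromℤ-* (ℤ.+ m)  -[1+ n ] = begin
    fromℤ (Sign.- ℤ.◃ (m ℕ.* suc n))    ≈⟨ fromℤ-[-◃] (m ℕ.* suc n) ⟩
    - ((m ℕ.* suc n) × 1#)              ≈⟨ -‿cong (×1-homo-* m (suc n)) ⟩
    - (m × 1# * suc n × 1#)             ≈⟨ -‿distribʳ-* _ _ ⟩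
    m × 1# * - (suc n × 1#)             ∎
  fromℤ-* (ℤ.+ m)  (ℤ.+ n)  = begin
    fromℤ (Sign.+ ℤ.◃ (m ℕ.* n))        ≡⟨ ≡.cong fromℤ (ℤ.+◃n≡+n (m ℕ.* n)) ⟩
    (m ℕ.* n) × 1#                      ≈⟨ ×1-homo-* m n ⟩
    m × 1# * n × 1#                     ∎

  fromℤ-neg : ∀ i → fromℤ (ℤ.- i) ≈ - fromℤ i
  fromℤ-neg -[1+ n ]    = ≈-sym (⁻¹-involutive _)
  fromℤ-neg (ℤ.+ zero)  = ≈-sym ε⁻¹≈ε
  fromℤ-neg (ℤ.+ suc n) = ≈-refl

  fromℤ-homomorphism : ℤ.+-*-rawRing -Raw-AlmostCommutative⟶ fromCommutativeRing R
  fromℤ-homomorphism = record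
    { ⟦_⟧    = fromℤ
    ; +-homo = fromℤ-+
    ; *-homo = fromℤ-*
    ; -‿homo = fromℤ-neg
    ; 0-homo = ≈-refl
    ; 1-homo = ≈-refl
    }

  fromℤ-≟ : ∀ i j → Maybe (fromℤ i ≈ fromℤ j)
  fromℤ-≟ i j with i ℤ.≟ j
  ... | yes ≡.refl = just ≈-refl
  ... | no _       = nothing

  open import Algebra.Solver.Ring ℤ.+-*-rawRing (fromCommutativeRing R) fromℤ-homomorphism fromℤ-≟ public

∀-punchIn : ∀ {m ℓ} {P : Fin (suc m) → Set ℓ} (p : Fin (suc m)) →
            P p → (∀ y → P (punchIn p y)) → ∀ x → P x
∀-punchIn {P = P} p Pp Pp↑ x with x Fin.≟ p
... | yes refl = Pp
... | no x≢p   = subst P (punchIn-punchOut (x≢p ∘ sym)) (Pp↑ _)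

deleteVertex : ∀ {m} → Graph (suc m) → Fin (suc m) → Graph m
deleteVertex G p = record
  { adj     = λ x y → adj G (punchIn p x) (punchIn p y)
  ; adj-sym = λ x y → adj-sym G (punchIn p x) (punchIn p y)
  ; irrefl  = λ x → irrefl G (punchIn p x)
  }

module _ (ℝ : RealField) where
  open RealField ℝ
  open import Data.Product using (_×_)
  open IsDecTotalOrder isDecTotalOrder using (_≟_; total; antisym)

  commutativeRing : CommutativeRing 0ℓ 0ℓ
  commutativeRing = record { isCommutativeRing = isCommutativeRing }

  open CommutativeRing commutativeRing using (+-identityˡ; +-identityʳ; zeroˡ; zeroʳ; *-comm; -‿inverseʳ)
  open IntegerCoefficientRingSolver commutativeRing using (Polynomial; solve; con; _:+_; _:*_; :-_; _:=_)
  open ≡-Reasoning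

  private
    `0 `1 : ∀ {n} → Polynomial n
    `0 = con (ℤ.+ 0)
    `1 = con (ℤ.+ 1)

  x*y≡0⇒y≡0 : ∀ {x y} → ¬ x ≡ 0r → x * y ≡ 0r → y ≡ 0r
  x*y≡0⇒y≡0 {x} {y} x≢0 xy≡0 with inverse x x≢0
  ... | x⁻¹ , xx⁻¹≡1 = begin
    y                ≡⟨ solve 1 (λ y → y := `1 :* y) refl y ⟩
    1r * y           ≡⟨ cong (_* y) xx⁻¹≡1 ⟨
    (x * x⁻¹) * y    ≡⟨ solve 3 (λ x x⁻¹ y → (x :* x⁻¹) :* y := x⁻¹ :* (x :* y)) refl x x⁻¹ y ⟩
    x⁻¹ * (x * y)    ≡⟨ cong (x⁻¹ *_) xy≡0 ⟩
    x⁻¹ * 0r         ≡⟨ zeroʳ x⁻¹ ⟩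
    0r               ∎

  x*y≡0⇒x≡0 : ∀ {x y} → ¬ y ≡ 0r → x * y ≡ 0r → x ≡ 0r
  x*y≡0⇒x≡0 {x} {y} y≢0 xy≡0 = x*y≡0⇒y≡0 y≢0 (trans (*-comm y x) xy≡0)

  x-y≡0⇒x≡y : ∀ {x y} → x + - y ≡ 0r → x ≡ y
  x-y≡0⇒x≡y {x} {y} x-y≡0 = begin
    x                ≡⟨ solve 2 (λ x y → x := (x :+ :- y) :+ y) refl x y ⟩
    (x + - y) + y    ≡⟨ cong (_+ y) x-y≡0 ⟩
    0r + y           ≡⟨ +-identityˡ y ⟩
    y                ∎

  1+1≢0 : ¬ 1r + 1r ≡ 0r
  1+1≢0 1+1≡0 = 0≢1 (antisym 0≤1 1≤0)
    where
    0≤1 : 0r ≤ 1r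
    0≤1 with total 0r 1r
    ... | inj₁ 0≤1 = 0≤1
    ... | inj₂ 1≤0 = subst (0r ≤_) (solve 0 (:- `1 :* :- `1 := `1) refl) (*-pos _ _ 0≤-1 0≤-1)
      where
      0≤-1 : 0r ≤ - 1r
      0≤-1 = subst₂ _≤_ (-‿inverseʳ 1r) (+-identityˡ (- 1r)) (+-mono-≤ 1r 0r (- 1r) 1≤0)
    1≤0 : 1r ≤ 0r
    1≤0 = subst₂ _≤_ (+-identityˡ 1r) 1+1≡0 (+-mono-≤ 0r 1r 1r 0≤1)

  -- Needs a third element besides 0 and s, which is where the ordering is used.
  ∃≢0∧≢ : ∀ s → ∃ λ α → ¬ α ≡ 0r × ¬ α + - s ≡ 0r
  ∃≢0∧≢ s with s ≟ 1r
  ... | yes refl = 1r + 1r , 1+1≢0 ,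
                   λ 2-1≡0 → 0≢1 (sym (trans (solve 0 (`1 := `1 :+ `1 :+ :- `1) refl) 2-1≡0))
  ... | no s≢1   = 1r , 0≢1 ∘ sym , λ 1-s≡0 → s≢1 (sym (x-y≡0⇒x≡y 1-s≡0))

  ∑ : ∀ {n} → (Fin n → R) → R
  ∑ = Defs.∑ ℝ

  infixl 5 _⊛_
  _⊛_ : ∀ {n} → Matrix ℝ n → Vector ℝ n → Vector ℝ n
  _⊛_ = Defs._⊛_ ℝ

  ⟨_,_⟩ : ∀ {n} → Vector ℝ n → Vector ℝ n → R
  ⟨ a , w ⟩ = ∑ (λ t → a t * w t)

  ∑-cong : ∀ {n} {f g : Fin n → R} → f ≗ g → ∑ f ≡ ∑ g
  ∑-cong {zero}  f≗g = refl
  ∑-cong {suc n} f≗g = cong₂ _+_ (f≗g zero) (∑-cong (f≗g ∘ suc))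

  ∑-0 : ∀ n → ∑ {n} (λ _ → 0r) ≡ 0r
  ∑-0 zero    = refl
  ∑-0 (suc n) = trans (cong (0r +_) (∑-0 n)) (+-identityʳ 0r)

  ∑-+ : ∀ {n} (f g : Fin n → R) → ∑ (λ t → f t + g t) ≡ ∑ f + ∑ g
  ∑-+ {zero}  f g = sym (+-identityʳ 0r)
  ∑-+ {suc n} f g = trans (cong ((f zero + g zero) +_) (∑-+ (f ∘ suc) (g ∘ suc)))
    (solve 4 (λ a b c d → (a :+ b) :+ (c :+ d) := (a :+ c) :+ (b :+ d)) refl (f zero) (g zero) _ _)

  ∑-*ˡ : ∀ {n} (c : R) (f : Fin n → R) → ∑ (λ t → c * f t) ≡ c * ∑ f
  ∑-*ˡ {zero}  c f = sym (zeroʳ c)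
  ∑-*ˡ {suc n} c f = trans (cong (c * f zero +_) (∑-*ˡ c (f ∘ suc)))
    (solve 3 (λ c a b → c :* a :+ c :* b := c :* (a :+ b)) refl c (f zero) _)

  ∑-neg : ∀ {n} (f : Fin n → R) → ∑ (λ t → - f t) ≡ - ∑ f
  ∑-neg f = begin
    ∑ (λ t → - f t)          ≡⟨ ∑-cong (λ t → solve 1 (λ a → :- a := :- `1 :* a) refl (f t)) ⟩
    ∑ (λ t → - 1r * f t)     ≡⟨ ∑-*ˡ (- 1r) f ⟩
    - 1r * ∑ f               ≡⟨ solve 1 (λ a → :- `1 :* a := :- a) refl (∑ f) ⟩
    - ∑ f                    ∎

  ∑-punchIn : ∀ {m} (p : Fin (suc m)) (f : Fin (suc m) → R) → ∑ f ≡ f p + ∑ (f ∘ punchIn p)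
  ∑-punchIn         zero    f = refl
  ∑-punchIn {suc m} (suc p) f = trans (cong (f zero +_) (∑-punchIn p (f ∘ suc)))
    (solve 3 (λ a b c → a :+ (b :+ c) := b :+ (a :+ c)) refl (f zero) (f (suc p)) _)

  ∑-swap : ∀ {n k} (f : Fin n → Fin k → R) → ∑ (λ x → ∑ (f x)) ≡ ∑ (λ y → ∑ (λ x → f x y))
  ∑-swap {zero}  {k} f = sym (∑-0 k)
  ∑-swap {suc n}     f = trans (cong (∑ (f zero) +_) (∑-swap (f ∘ suc)))
    (sym (∑-+ (f zero) (λ y → ∑ (λ x → f (suc x) y))))

  ⟨⟩-comm : ∀ {n} (a w : Vector ℝ n) → ⟨ a , w ⟩ ≡ ⟨ w , a ⟩
  ⟨⟩-comm a w = ∑-cong (λ t → *-comm (a t) (w t))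

  ⟨⟩-linearʳ : ∀ {n} (a : Vector ℝ n) (c d : R) (u w : Vector ℝ n) →
               ⟨ a , (λ t → c * u t + d * w t) ⟩ ≡ c * ⟨ a , u ⟩ + d * ⟨ a , w ⟩
  ⟨⟩-linearʳ a c d u w = begin
    ⟨ a , (λ t → c * u t + d * w t) ⟩
      ≡⟨ ∑-cong (λ t → solve 5 (λ a c d u w → a :* (c :* u :+ d :* w) := c :* (a :* u) :+ d :* (a :* w))
                              refl (a t) c d (u t) (w t)) ⟩
    ∑ (λ t → c * (a t * u t) + d * (a t * w t))
      ≡⟨ ∑-+ (λ t → c * (a t * u t)) (λ t → d * (a t * w t)) ⟩
    ∑ (λ t → c * (a t * u t)) + ∑ (λ t → d * (a t * w t))
      ≡⟨ cong₂ _+_ (∑-*ˡ c (λ t → a t * u t)) (∑-*ˡ d (λ t → a t * w t)) ⟩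
    c * ⟨ a , u ⟩ + d * ⟨ a , w ⟩
      ∎

  ⟨⟩-*ʳ : ∀ {n} (a : Vector ℝ n) (c : R) (w : Vector ℝ n) → ⟨ a , (λ t → c * w t) ⟩ ≡ c * ⟨ a , w ⟩
  ⟨⟩-*ʳ a c w = trans (∑-cong (λ t → solve 3 (λ a c w → a :* (c :* w) := c :* (a :* w)) refl (a t) c (w t)))
                      (∑-*ˡ c (λ t → a t * w t))

  ⟨⟩-negʳ : ∀ {n} (a w : Vector ℝ n) → ⟨ a , (λ t → - w t) ⟩ ≡ - ⟨ a , w ⟩
  ⟨⟩-negʳ a w = trans (∑-cong (λ t → solve 2 (λ a w → a :* :- w := :- (a :* w)) refl (a t) (w t)))
                      (∑-neg (λ t → a t * w t))

  ⟨⟩-zeroʳ : ∀ {n} (a w : Vector ℝ n) → (∀ t → w t ≡ 0r) → ⟨ a , w ⟩ ≡ 0r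
  ⟨⟩-zeroʳ {n} a w w≡0 = trans (∑-cong (λ t → trans (cong (a t *_) (w≡0 t)) (zeroʳ (a t)))) (∑-0 n)

  ⟨⟩-insertAt : ∀ {m} (p : Fin (suc m)) (a w : Vector ℝ m) (α β : R) →
                ⟨ insertAt a p α , insertAt w p β ⟩ ≡ α * β + ⟨ a , w ⟩
  ⟨⟩-insertAt p a w α β = trans (∑-punchIn p (λ t → insertAt a p α t * insertAt w p β t))
    (cong₂ _+_ (cong₂ _*_ (insertAt-lookup a p α) (insertAt-lookup w p β))
               (∑-cong (λ y → cong₂ _*_ (insertAt-punchIn a p α y) (insertAt-punchIn w p β y))))

  ⊛-selfAdjoint : ∀ {n} (B : Matrix ℝ n) → Symmetric ℝ B →
                  ∀ u w → ⟨ u , B ⊛ w ⟩ ≡ ⟨ B ⊛ u , w ⟩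
  ⊛-selfAdjoint B B-sym u w = begin
    ∑ (λ x → u x * ∑ (λ y → B x y * w y))     ≡⟨ ∑-cong (λ x → sym (∑-*ˡ (u x) (λ y → B x y * w y))) ⟩
    ∑ (λ x → ∑ (λ y → u x * (B x y * w y)))   ≡⟨ ∑-swap (λ x y → u x * (B x y * w y)) ⟩
    ∑ (λ y → ∑ (λ x → u x * (B x y * w y)))   ≡⟨ ∑-cong (λ y → ∑-cong (λ x →
        trans (cong (λ e → u x * (e * w y)) (B-sym x y))
              (solve 3 (λ u b w → u :* (b :* w) := w :* (b :* u)) refl (u x) (B y x) (w y)))) ⟩
    ∑ (λ y → ∑ (λ x → w y * (B y x * u x)))   ≡⟨ ∑-cong (λ y → ∑-*ˡ (w y) (λ x → B y x * u x)) ⟩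
    ∑ (λ y → w y * (B ⊛ u) y)                 ≡⟨ ⟨⟩-comm w (B ⊛ u) ⟩
    ⟨ B ⊛ u , w ⟩                             ∎

  Injective : ∀ {n} → Matrix ℝ n → Set
  Injective A = ∀ v → InKernel ℝ A v → ∀ t → v t ≡ 0r

  Surjective : ∀ {n} → Matrix ℝ n → Set
  Surjective A = ∀ r → ∃ λ v → A ⊛ v ≗ r

  KernelSpannedBy : ∀ {n} → Matrix ℝ n → Vector ℝ n → Set
  KernelSpannedBy A u = ∀ v → InKernel ℝ A v → ∃ λ c → ∀ t → v t ≡ c * u t

  InKernel-resp : ∀ {n} {A B : Matrix ℝ n} {v} → (∀ x y → A x y ≡ B x y) → InKernel ℝ A v → InKernel ℝ B v
  InKernel-resp {v = v} A≗B Av≡0 x = trans (∑-cong (λ t → cong (_* v t) (sym (A≗B x t)))) (Av≡0 x)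

  Nullity-resp : ∀ {n k} {A B : Matrix ℝ n} → (∀ x y → A x y ≡ B x y) → Nullity ℝ A k → Nullity ℝ B k
  Nullity-resp A≗B ((vs , vs∈ker , indep) , ¬more) =
    (vs , InKernel-resp A≗B ∘ vs∈ker , indep) ,
    λ { (ws , ws∈ker , indep′) →
          ¬more (ws , InKernel-resp (λ x y → sym (A≗B x y)) ∘ ws∈ker , indep′) }

  injective⇒nullity0 : ∀ {n} (A : Matrix ℝ n) → Injective A → Nullity ℝ A 0
  injective⇒nullity0 A A-inj = ((λ ()) , (λ ()) , (λ _ _ ())) , λ { (vs , vs∈ker , indep) →
    0≢1 (sym (indep (λ _ → 1r)
                    (λ t → trans (cong (λ e → 1r * e + 0r) (A-inj (vs zero) (vs∈ker zero) t))
                                 (solve 0 (`1 :* `0 :+ `0 := `0) refl))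
                    zero)) }

  spanned⇒nullity1 : ∀ {n} (A : Matrix ℝ n) (p : Fin n) (u : Vector ℝ n) →
                     InKernel ℝ A u → ¬ u p ≡ 0r → KernelSpannedBy A u → Nullity ℝ A 1
  spanned⇒nullity1 A p u u∈ker up≢0 spans = ((λ _ → u) , (λ _ → u∈ker) , u-indep) , ¬two
    where
    u-indep : LinIndep ℝ (λ (_ : Fin 1) → u)
    u-indep c cu≡0 zero = x*y≡0⇒x≡0 up≢0 (trans (sym (+-identityʳ _)) (cu≡0 p))

    -- Kernel vectors v₀ = c₀ u and v₁ = c₁ u satisfy c₁ v₀ − c₀ v₁ = 0, so independence
    -- forces c₁ = 0, i.e. v₁ = 0, contradicting independence once more.
    ¬two : ¬ HasIndepKernel ℝ A 2
    ¬two (vs , vs∈ker , indep) = 0≢1 (sym (indep (λ { zero → 0r ; (suc zero) → 1r }) v₁-alone (suc zero)))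
      where
      v₀ v₁ : Vector ℝ _
      v₀ = vs zero
      v₁ = vs (suc zero)
      c₀ c₁ : R
      c₀ = proj₁ (spans v₀ (vs∈ker zero))
      c₁ = proj₁ (spans v₁ (vs∈ker (suc zero)))
      v₀≡c₀u : ∀ t → v₀ t ≡ c₀ * u t
      v₀≡c₀u = proj₂ (spans v₀ (vs∈ker zero))
      v₁≡c₁u : ∀ t → v₁ t ≡ c₁ * u t
      v₁≡c₁u = proj₂ (spans v₁ (vs∈ker (suc zero)))

      dependency : ∀ t → c₁ * v₀ t + (- c₀ * v₁ t + 0r) ≡ 0r
      dependency t = begin
        c₁ * v₀ t + (- c₀ * v₁ t + 0r)
          ≡⟨ cong₂ (λ e f → c₁ * e + (- c₀ * f + 0r)) (v₀≡c₀u t) (v₁≡c₁u t) ⟩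
        c₁ * (c₀ * u t) + (- c₀ * (c₁ * u t) + 0r)
          ≡⟨ solve 3 (λ c₀ c₁ u → c₁ :* (c₀ :* u) :+ (:- c₀ :* (c₁ :* u) :+ `0) := `0) refl c₀ c₁ (u t) ⟩
        0r
          ∎

      c₁≡0 : c₁ ≡ 0r
      c₁≡0 = indep (λ { zero → c₁ ; (suc zero) → - c₀ }) dependency zero

      v₁-alone : ∀ t → 0r * v₀ t + (1r * v₁ t + 0r) ≡ 0r
      v₁-alone t = begin
        0r * v₀ t + (1r * v₁ t + 0r)          ≡⟨ cong (λ e → 0r * v₀ t + (1r * e + 0r)) (v₁≡c₁u t) ⟩
        0r * v₀ t + (1r * (c₁ * u t) + 0r)    ≡⟨ cong (λ e → 0r * v₀ t + (1r * (e * u t) + 0r)) c₁≡0 ⟩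
        0r * v₀ t + (1r * (0r * u t) + 0r)    ≡⟨ solve 2 (λ v u → `0 :* v :+ (`1 :* (`0 :* u) :+ `0) := `0)
                                                         refl (v₀ t) (u t) ⟩
        0r                                    ∎

  -- A sends column k of X to y k eᵢ, so A kills y l X₋ₖ − y k X₋ₗ. A nonzero y l then kills row l
  -- (as X l l = 0), and with it, by symmetry, all of X.
  injective⇒SNIP : ∀ {m} (A : Matrix ℝ (suc m)) (i : Fin (suc m)) → Injective A → SNIP-at ℝ A i
  injective⇒SNIP {m} A i A-inj X X-sym _ X-diag AX-rows j k = Xjk≡0 (all? (λ l → y l ≟ 0r))
    where
    y : Vector ℝ (suc m)
    y l = (A ⊛ (λ t → X t l)) i

    proportional : ∀ k l t → y l * X t k ≡ y k * X t l
    proportional k l t = x-y≡0⇒x≡y (trans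
      (solve 3 (λ a b c → a :+ :- (b :* c) := a :+ :- b :* c) refl (y l * X t k) (y k) (X t l))
      (A-inj (λ t → y l * X t k + - y k * X t l) combination∈ker t))
      where
      combination∈ker : InKernel ℝ A (λ t → y l * X t k + - y k * X t l)
      combination∈ker = ∀-punchIn i
        (trans (⟨⟩-linearʳ (A i) (y l) (- y k) (λ t → X t k) (λ t → X t l))
               (solve 2 (λ a b → a :* b :+ :- b :* a := `0) refl (y l) (y k)))
        (λ x → trans (⟨⟩-linearʳ (A (punchIn i x)) (y l) (- y k) (λ t → X t k) (λ t → X t l))
                     (trans (cong₂ (λ e f → y l * e + - y k * f)
                                   (AX-rows (punchIn i x) k (punchInᵢ≢i i x))
                                   (AX-rows (punchIn i x) l (punchInᵢ≢i i x)))
                            (solve 2 (λ a b → a :* `0 :+ :- b :* `0 := `0) refl (y l) (y k))))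

    Xjk≡0 : Dec (∀ l → y l ≡ 0r) → X j k ≡ 0r
    Xjk≡0 (yes y≡0) =
      A-inj (λ t → X t k) (∀-punchIn i (y≡0 k) (λ x → AX-rows (punchIn i x) k (punchInᵢ≢i i x))) j
    Xjk≡0 (no y≢0) with ¬∀⟶∃¬ (suc m) (λ l → y l ≡ 0r) (λ l → y l ≟ 0r) y≢0
    ... | l , yl≢0 = x*y≡0⇒y≡0 yl≢0 (begin
      y l * X j k  ≡⟨ proportional k l j ⟩
      y k * X j l  ≡⟨ cong (y k *_) (trans (X-sym j l) (row-l≡0 j)) ⟩
      y k * 0r     ≡⟨ zeroʳ (y k) ⟩
      0r           ∎)
      where
      row-l≡0 : ∀ k → X l k ≡ 0r
      row-l≡0 k = x*y≡0⇒y≡0 yl≢0 (trans (proportional k l l) (trans (cong (y k *_) (X-diag l)) (zeroʳ (y k))))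

  border : ∀ {m} → Fin (suc m) → Matrix ℝ m → Vector ℝ m → R → Matrix ℝ (suc m)
  border p C b d = insertAt (λ x → insertAt (C x) p (b x)) p (insertAt b p d)

  module _ {m} (p : Fin (suc m)) (C : Matrix ℝ m) (b : Vector ℝ m) (d : R) where

    private
      rows : Fin m → Vector ℝ (suc m)
      rows x = insertAt (C x) p (b x)

    border-pivot-pivot : border p C b d p p ≡ d
    border-pivot-pivot = trans (cong-app (insertAt-lookup rows p (insertAt b p d)) p) (insertAt-lookup b p d)

    border-pivot-punchIn : ∀ y → border p C b d p (punchIn p y) ≡ b y
    border-pivot-punchIn y = trans (cong-app (insertAt-lookup rows p (insertAt b p d)) (punchIn p y))
                                   (insertAt-punchIn b p d y)

    border-punchIn-pivot : ∀ x → border p C b d (punchIn p x) p ≡ b x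
    border-punchIn-pivot x = trans (cong-app (insertAt-punchIn rows p (insertAt b p d) x) p)
                                   (insertAt-lookup (C x) p (b x))

    border-punchIn-punchIn : ∀ x y → border p C b d (punchIn p x) (punchIn p y) ≡ C x y
    border-punchIn-punchIn x y = trans (cong-app (insertAt-punchIn rows p (insertAt b p d) x) (punchIn p y))
                                       (insertAt-punchIn (C x) p (b x) y)

    border-⊛-pivot : ∀ v → (border p C b d ⊛ v) p ≡ d * v p + ⟨ b , v ∘ punchIn p ⟩
    border-⊛-pivot v = trans (∑-punchIn p (λ t → border p C b d p t * v t))
      (cong₂ _+_ (cong (_* v p) border-pivot-pivot)
                 (∑-cong (λ y → cong (_* v (punchIn p y)) (border-pivot-punchIn y))))

    border-⊛-punchIn : ∀ v x → (border p C b d ⊛ v) (punchIn p x) ≡ b x * v p + (C ⊛ v ∘ punchIn p) x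
    border-⊛-punchIn v x = trans (∑-punchIn p (λ t → border p C b d (punchIn p x) t * v t))
      (cong₂ _+_ (cong (_* v p) (border-punchIn-pivot x))
                 (∑-cong (λ y → cong (_* v (punchIn p y)) (border-punchIn-punchIn x y))))

    border-⊛-insertAt-pivot : ∀ w β → (border p C b d ⊛ insertAt w p β) p ≡ d * β + ⟨ b , w ⟩
    border-⊛-insertAt-pivot w β = trans (border-⊛-pivot (insertAt w p β))
      (cong₂ (λ e f → d * e + f) (insertAt-lookup w p β)
                                 (∑-cong (λ y → cong (b y *_) (insertAt-punchIn w p β y))))

    border-⊛-insertAt-punchIn : ∀ w β x → (border p C b d ⊛ insertAt w p β) (punchIn p x) ≡ b x * β + (C ⊛ w) x
    border-⊛-insertAt-punchIn w β x = trans (border-⊛-punchIn (insertAt w p β) x)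
      (cong₂ (λ e f → b x * e + f) (insertAt-lookup w p β)
                                   (∑-cong (λ y → cong (C x y *_) (insertAt-punchIn w p β y))))

  nonzero⇔-resp : ∀ {e f : R} {Q : Set} → e ≡ f → (¬ f ≡ 0r) ⇔ Q → (¬ e ≡ 0r) ⇔ Q
  nonzero⇔-resp refl f≢0⇔Q = f≢0⇔Q

  border-InS : ∀ {m} (G : Graph (suc m)) (p : Fin (suc m)) {C b} (d : R) →
               InS ℝ (deleteVertex G p) C →
               (∀ y → (¬ b y ≡ 0r) ⇔ (adj G p (punchIn p y) ≡ true)) →
               InS ℝ G (border p C b d)
  border-InS {m} G p {C} {b} d (C-sym , C-pattern) b-pattern = symmetric , nonzero⇔edge
    where
    B : Matrix ℝ (suc m)
    B = border p C b d

    symmetric : Symmetric ℝ B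
    symmetric = ∀-punchIn p
      (∀-punchIn p refl
        (λ y → trans (border-pivot-punchIn p C b d y) (sym (border-punchIn-pivot p C b d y))))
      (λ x → ∀-punchIn p
        (trans (border-punchIn-pivot p C b d x) (sym (border-pivot-punchIn p C b d x)))
        (λ y → trans (border-punchIn-punchIn p C b d x y)
                     (trans (C-sym x y) (sym (border-punchIn-punchIn p C b d y x)))))

    nonzero⇔edge : ∀ j k → ¬ j ≡ k → (¬ B j k ≡ 0r) ⇔ (adj G j k ≡ true)
    nonzero⇔edge = ∀-punchIn p
      (∀-punchIn p (λ p≢p → ⊥-elim (p≢p refl))
                   (λ y _ → nonzero⇔-resp (border-pivot-punchIn p C b d y) (b-pattern y)))
      (λ x → ∀-punchIn p
        (λ _ → nonzero⇔-resp (border-punchIn-pivot p C b d x)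
                 (subst (λ e → _ ⇔ e ≡ true) (adj-sym G p (punchIn p x)) (b-pattern x)))
        (λ y x≢y → nonzero⇔-resp (border-punchIn-punchIn p C b d x y)
                     (C-pattern x y (x≢y ∘ cong (punchIn p)))))

  indicator : Bool → R
  indicator true  = 1r
  indicator false = 0r

  indicator-nonzero⇔ : ∀ β → (¬ indicator β ≡ 0r) ⇔ (β ≡ true)
  indicator-nonzero⇔ true  = mk⇔ (λ _ → refl) (λ _ → 0≢1 ∘ sym)
  indicator-nonzero⇔ false = mk⇔ (λ 0≢0 → ⊥-elim (0≢0 refl)) (λ ())

  neighbours : ∀ {m} → Graph (suc m) → (p : Fin (suc m)) → Vector ℝ m
  neighbours G p y = indicator (adj G p (punchIn p y))

  neighbours-nonzero⇔ : ∀ {m} (G : Graph (suc m)) p y →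
                        (¬ neighbours G p y ≡ 0r) ⇔ (adj G p (punchIn p y) ≡ true)
  neighbours-nonzero⇔ G p y = indicator-nonzero⇔ (adj G p (punchIn p y))

  module Bordering {m} (p : Fin (suc m)) (C : Matrix ℝ m) (b : Vector ℝ m) (d : R)
                   (C-inj : Injective C) (z : Vector ℝ m) (Cz≗b : C ⊛ z ≗ b) where

    B : Matrix ℝ (suc m)
    B = border p C b d

    schur : R
    schur = d + - ⟨ b , z ⟩

    kernel-off-pivot : ∀ v → InKernel ℝ B v → ∀ y → v (punchIn p y) ≡ - v p * z y
    kernel-off-pivot v Bv≡0 y = x-y≡0⇒x≡y (begin
      v′ y + - (- v p * z y)   ≡⟨ solve 3 (λ w v z → w :+ :- (:- v :* z) := `1 :* w :+ v :* z) refl (v′ y) (v p) (z y) ⟩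
      1r * v′ y + v p * z y    ≡⟨ C-inj (λ y → 1r * v′ y + v p * z y) shifted∈ker y ⟩
      0r                       ∎)
      where
      v′ : Vector ℝ m
      v′ = v ∘ punchIn p
      shifted∈ker : InKernel ℝ C (λ y → 1r * v′ y + v p * z y)
      shifted∈ker x = begin
        ⟨ C x , (λ y → 1r * v′ y + v p * z y) ⟩   ≡⟨ ⟨⟩-linearʳ (C x) 1r (v p) v′ z ⟩
        1r * (C ⊛ v′) x + v p * (C ⊛ z) x         ≡⟨ cong (λ e → 1r * (C ⊛ v′) x + v p * e) (Cz≗b x) ⟩
        1r * (C ⊛ v′) x + v p * b x               ≡⟨ solve 3 (λ w vp b → `1 :* w :+ vp :* b := b :* vp :+ w)
                                                             refl ((C ⊛ v′) x) (v p) (b x) ⟩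
        b x * v p + (C ⊛ v′) x                    ≡⟨ border-⊛-punchIn p C b d v x ⟨
        (B ⊛ v) (punchIn p x)                     ≡⟨ Bv≡0 (punchIn p x) ⟩
        0r                                        ∎

    kernel-pivot : ∀ v → InKernel ℝ B v → v p * schur ≡ 0r
    kernel-pivot v Bv≡0 = begin
      v p * (d + - ⟨ b , z ⟩)                ≡⟨ solve 3 (λ vp d s → vp :* (d :+ :- s) := d :* vp :+ :- vp :* s)
                                                        refl (v p) d ⟨ b , z ⟩ ⟩
      d * v p + - v p * ⟨ b , z ⟩             ≡⟨ cong (d * v p +_) (⟨⟩-*ʳ b (- v p) z) ⟨
      d * v p + ⟨ b , (λ y → - v p * z y) ⟩   ≡⟨ cong (d * v p +_) (∑-cong (λ y → cong (b y *_)
                                                                   (sym (kernel-off-pivot v Bv≡0 y)))) ⟩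
      d * v p + ⟨ b , v ∘ punchIn p ⟩         ≡⟨ border-⊛-pivot p C b d v ⟨
      (B ⊛ v) p                               ≡⟨ Bv≡0 p ⟩
      0r                                      ∎

    injective : ¬ schur ≡ 0r → Injective B
    injective schur≢0 v Bv≡0 = ∀-punchIn p vp≡0 (λ y → begin
      v (punchIn p y)   ≡⟨ kernel-off-pivot v Bv≡0 y ⟩
      - v p * z y       ≡⟨ cong (λ e → - e * z y) vp≡0 ⟩
      - 0r * z y        ≡⟨ solve 1 (λ z → :- `0 :* z := `0) refl (z y) ⟩
      0r                ∎)
      where
      vp≡0 : v p ≡ 0r
      vp≡0 = x*y≡0⇒x≡0 schur≢0 (kernel-pivot v Bv≡0)

    surjective : Surjective C → ¬ schur ≡ 0r → Surjective B
    surjective C-surj schur≢0 r with C-surj (r ∘ punchIn p) | inverse schur schur≢0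
    ... | w , Cw≗r′ | schur⁻¹ , schur*schur⁻¹≡1 = insertAt v′ p v₀ , ∀-punchIn p pivot-row (λ x → begin
      (B ⊛ insertAt v′ p v₀) (punchIn p x)             ≡⟨ border-⊛-insertAt-punchIn p C b d v′ v₀ x ⟩
      b x * v₀ + (C ⊛ v′) x                            ≡⟨ cong (b x * v₀ +_) (⟨⟩-linearʳ (C x) 1r (- v₀) w z) ⟩
      b x * v₀ + (1r * (C ⊛ w) x + - v₀ * (C ⊛ z) x)   ≡⟨ cong₂ (λ e f → b x * v₀ + (1r * e + - v₀ * f))
                                                                (Cw≗r′ x) (Cz≗b x) ⟩
      b x * v₀ + (1r * r (punchIn p x) + - v₀ * b x)   ≡⟨ solve 3 (λ b v₀ r → b :* v₀ :+ (`1 :* r :+ :- v₀ :* b) := r)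
                                                                refl (b x) v₀ (r (punchIn p x)) ⟩
      r (punchIn p x)                                  ∎)
      where
      -- v₀ solves schur * v₀ = r p − ⟨ b , w ⟩, the pivot equation left after eliminating C.
      v₀ : R
      v₀ = schur⁻¹ * (r p + - ⟨ b , w ⟩)
      v′ : Vector ℝ m
      v′ y = 1r * w y + - v₀ * z y
      pivot-row : (B ⊛ insertAt v′ p v₀) p ≡ r p
      pivot-row = begin
        (B ⊛ insertAt v′ p v₀) p
          ≡⟨ border-⊛-insertAt-pivot p C b d v′ v₀ ⟩
        d * v₀ + ⟨ b , v′ ⟩
          ≡⟨ cong (d * v₀ +_) (⟨⟩-linearʳ b 1r (- v₀) w z) ⟩
        d * v₀ + (1r * ⟨ b , w ⟩ + - v₀ * ⟨ b , z ⟩)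
          ≡⟨ solve 5 (λ d s⁻¹ rp bw bz →
                        d :* (s⁻¹ :* (rp :+ :- bw)) :+ (`1 :* bw :+ :- (s⁻¹ :* (rp :+ :- bw)) :* bz)
                        := (d :+ :- bz) :* s⁻¹ :* (rp :+ :- bw) :+ bw)
                     refl d schur⁻¹ (r p) ⟨ b , w ⟩ ⟨ b , z ⟩ ⟩
        schur * schur⁻¹ * (r p + - ⟨ b , w ⟩) + ⟨ b , w ⟩
          ≡⟨ cong (λ e → e * (r p + - ⟨ b , w ⟩) + ⟨ b , w ⟩) schur*schur⁻¹≡1 ⟩
        1r * (r p + - ⟨ b , w ⟩) + ⟨ b , w ⟩
          ≡⟨ solve 2 (λ rp bw → `1 :* (rp :+ :- bw) :+ bw := rp) refl (r p) ⟨ b , w ⟩ ⟩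
        r p
          ∎

    nullVector : Vector ℝ (suc m)
    nullVector = insertAt (λ y → - z y) p 1r

    nullVector-pivot≢0 : ¬ nullVector p ≡ 0r
    nullVector-pivot≢0 u₀≡0 = 0≢1 (sym (trans (sym (insertAt-lookup (λ y → - z y) p 1r)) u₀≡0))

    kernel⊆span-nullVector : KernelSpannedBy B nullVector
    kernel⊆span-nullVector v Bv≡0 = v p , ∀-punchIn p
      (begin
        v p                        ≡⟨ solve 1 (λ x → x := x :* `1) refl (v p) ⟩
        v p * 1r                   ≡⟨ cong (v p *_) (insertAt-lookup (λ y → - z y) p 1r) ⟨
        v p * nullVector p         ∎)
      (λ y → begin
        v (punchIn p y)                ≡⟨ kernel-off-pivot v Bv≡0 y ⟩
        - v p * z y                    ≡⟨ solve 2 (λ a z → :- a :* z := a :* :- z) refl (v p) (z y) ⟩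
        v p * - z y                    ≡⟨ cong (v p *_) (insertAt-punchIn (λ y → - z y) p 1r y) ⟨
        v p * nullVector (punchIn p y) ∎)

    nullVector∈ker : schur ≡ 0r → InKernel ℝ B nullVector
    nullVector∈ker schur≡0 = ∀-punchIn p
      (begin
        (B ⊛ nullVector) p               ≡⟨ border-⊛-insertAt-pivot p C b d (λ y → - z y) 1r ⟩
        d * 1r + ⟨ b , (λ y → - z y) ⟩   ≡⟨ cong (d * 1r +_) (⟨⟩-negʳ b z) ⟩
        d * 1r + - ⟨ b , z ⟩             ≡⟨ solve 2 (λ d s → d :* `1 :+ :- s := d :+ :- s) refl d ⟨ b , z ⟩ ⟩
        schur                            ≡⟨ schur≡0 ⟩
        0r                               ∎)
      (λ x → begin
        (B ⊛ nullVector) (punchIn p x)   ≡⟨ border-⊛-insertAt-punchIn p C b d (λ y → - z y) 1r x ⟩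
        b x * 1r + ⟨ C x , (λ y → - z y) ⟩ ≡⟨ cong (b x * 1r +_) (trans (⟨⟩-negʳ (C x) z) (cong -_ (Cz≗b x))) ⟩
        b x * 1r + - b x                 ≡⟨ solve 1 (λ b → b :* `1 :+ :- b := `0) refl (b x) ⟩
        0r                               ∎)

  -- Pairing the non-pivot rows with the null vector u of B removes B (it is self-adjoint),
  -- leaving v p ⟨ u , a ⟩ = 0; then the non-pivot part is a multiple of u killed by the pivot row.
  border-injective-corank1 : ∀ {m} (p : Fin (suc m)) (B : Matrix ℝ m) (a : Vector ℝ m) (d : R) (u : Vector ℝ m) →
                             Symmetric ℝ B → InKernel ℝ B u → KernelSpannedBy B u → ¬ ⟨ u , a ⟩ ≡ 0r →
                             Injective (border p B a d)
  border-injective-corank1 {m} p B a d u B-sym u∈ker spans ua≢0 v Av≡0 = ∀-punchIn p vp≡0 (λ y → begin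
    v′ y         ≡⟨ v′≡cu y ⟩
    c * u y      ≡⟨ cong (_* u y) c≡0 ⟩
    0r * u y     ≡⟨ zeroˡ (u y) ⟩
    0r           ∎)
    where
    v′ : Vector ℝ m
    v′ = v ∘ punchIn p

    row : ∀ x → a x * v p + (B ⊛ v′) x ≡ 0r
    row x = trans (sym (border-⊛-punchIn p B a d v x)) (Av≡0 (punchIn p x))

    ⟨u,Bv′⟩≡0 : ⟨ u , B ⊛ v′ ⟩ ≡ 0r
    ⟨u,Bv′⟩≡0 = begin
      ⟨ u , B ⊛ v′ ⟩   ≡⟨ ⊛-selfAdjoint B B-sym u v′ ⟩
      ⟨ B ⊛ u , v′ ⟩   ≡⟨ ⟨⟩-comm (B ⊛ u) v′ ⟩
      ⟨ v′ , B ⊛ u ⟩   ≡⟨ ⟨⟩-zeroʳ v′ (B ⊛ u) u∈ker ⟩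
      0r               ∎

    vp≡0 : v p ≡ 0r
    vp≡0 = x*y≡0⇒y≡0 ua≢0 (begin
      ⟨ u , a ⟩ * v p
        ≡⟨ solve 2 (λ s vp → s :* vp := vp :* s :+ `1 :* `0) refl ⟨ u , a ⟩ (v p) ⟩
      v p * ⟨ u , a ⟩ + 1r * 0r
        ≡⟨ cong (λ e → v p * ⟨ u , a ⟩ + 1r * e) ⟨u,Bv′⟩≡0 ⟨
      v p * ⟨ u , a ⟩ + 1r * ⟨ u , B ⊛ v′ ⟩
        ≡⟨ ⟨⟩-linearʳ u (v p) 1r a (B ⊛ v′) ⟨
      ⟨ u , (λ x → v p * a x + 1r * (B ⊛ v′) x) ⟩
        ≡⟨ ⟨⟩-zeroʳ u _ (λ x → trans (solve 3 (λ vp a w → vp :* a :+ `1 :* w := a :* vp :+ w)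
                                                  refl (v p) (a x) ((B ⊛ v′) x))
                                       (row x)) ⟩
      0r
        ∎)

    Bv′≡0 : InKernel ℝ B v′
    Bv′≡0 x = begin
      (B ⊛ v′) x                ≡⟨ solve 2 (λ a w → w := a :* `0 :+ w) refl (a x) ((B ⊛ v′) x) ⟩
      a x * 0r + (B ⊛ v′) x     ≡⟨ cong (λ e → a x * e + (B ⊛ v′) x) vp≡0 ⟨
      a x * v p + (B ⊛ v′) x    ≡⟨ row x ⟩
      0r                        ∎

    c : R
    c = proj₁ (spans v′ Bv′≡0)

    v′≡cu : ∀ t → v′ t ≡ c * u t
    v′≡cu = proj₂ (spans v′ Bv′≡0)

    c≡0 : c ≡ 0r
    c≡0 = x*y≡0⇒x≡0 ua≢0 (begin
      c * ⟨ u , a ⟩                 ≡⟨ cong (c *_) (⟨⟩-comm u a) ⟩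
      c * ⟨ a , u ⟩                 ≡⟨ ⟨⟩-*ʳ a c u ⟨
      ⟨ a , (λ t → c * u t) ⟩       ≡⟨ ∑-cong (λ t → cong (a t *_) (v′≡cu t)) ⟨
      ⟨ a , v′ ⟩                    ≡⟨ solve 2 (λ d s → s := d :* `0 :+ s) refl d (⟨ a , v′ ⟩) ⟩
      d * 0r + ⟨ a , v′ ⟩           ≡⟨ cong (λ e → d * e + ⟨ a , v′ ⟩) vp≡0 ⟨
      d * v p + ⟨ a , v′ ⟩          ≡⟨ border-⊛-pivot p B a d v ⟨
      (border p B a d ⊛ v) p        ≡⟨ Av≡0 p ⟩
      0r                            ∎)

  nonsingular-realisation : ∀ {n} (G : Graph n) → ∃ λ C → InS ℝ G C × Injective C × Surjective C
  nonsingular-realisation {zero}  G = (λ ()) , ((λ ()) , (λ ())) , (λ _ _ ()) , λ _ → (λ ()) , λ ()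
  nonsingular-realisation {suc n} G with nonsingular-realisation (deleteVertex G zero)
  ... | C , C∈S , C-inj , C-surj =
    border zero C b d , border-InS G zero d C∈S (neighbours-nonzero⇔ G zero) ,
    injective schur≢0 , surjective C-surj schur≢0
    where
    b : Vector ℝ n
    b = neighbours G zero
    z : Vector ℝ n
    z = proj₁ (C-surj b)
    d : R
    d = 1r + ⟨ b , z ⟩
    open Bordering zero C b d C-inj z (proj₂ (C-surj b))
    schur≢0 : ¬ schur ≡ 0r
    schur≢0 schur≡0 = 0≢1 (sym (trans (solve 1 (λ s → `1 := `1 :+ s :+ :- s) refl ⟨ b , z ⟩) schur≡0))

  allows-0-1 : ∀ {m} (G : Graph (suc (suc m))) (i : Fin (suc (suc m))) (j : Fin (suc m)) →
               adj G i (punchIn i j) ≡ true → AllowsSNIP ℝ G i 0 1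
  allows-0-1 {m} G i j i~j with nonsingular-realisation (deleteVertex (deleteVertex G i) j)
  ... | C , C∈S , C-inj , C-surj with C-surj (neighbours (deleteVertex G i) j)
  ... | z , Cz≗b with ∃≢0∧≢ ⟨ neighbours G i ∘ punchIn j , z ⟩
  ... | α , α≢0 , α-s≢0 =
    A , A∈S , injective⇒SNIP A i A-inj , injective⇒nullity0 A A-inj ,
    Nullity-resp (λ x y → sym (border-punchIn-punchIn i B a 0r x y))
                 (spanned⇒nullity1 B j u u∈ker nullVector-pivot≢0 kernel⊆span-nullVector)
    where
    H : Graph (suc m)
    H = deleteVertex G i
    b : Vector ℝ m
    b = neighbours H j
    open Bordering j C b ⟨ b , z ⟩ C-inj z Cz≗b
    u : Vector ℝ (suc m)
    u = nullVector
    u∈ker : InKernel ℝ B u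
    u∈ker = nullVector∈ker (-‿inverseʳ ⟨ b , z ⟩)
    B∈S : InS ℝ H B
    B∈S = border-InS H j ⟨ b , z ⟩ C∈S (neighbours-nonzero⇔ H j)
    a″ : Vector ℝ m
    a″ = neighbours G i ∘ punchIn j
    a : Vector ℝ (suc m)
    a = insertAt a″ j α
    a-pattern : ∀ y → (¬ a y ≡ 0r) ⇔ (adj G i (punchIn i y) ≡ true)
    a-pattern = ∀-punchIn j
      (nonzero⇔-resp (insertAt-lookup a″ j α) (mk⇔ (λ _ → i~j) (λ _ → α≢0)))
      (λ y → nonzero⇔-resp (insertAt-punchIn a″ j α y) (neighbours-nonzero⇔ G i (punchIn j y)))
    ⟨u,a⟩≢0 : ¬ ⟨ u , a ⟩ ≡ 0r
    ⟨u,a⟩≢0 ⟨u,a⟩≡0 = α-s≢0 (begin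
      α + - ⟨ a″ , z ⟩                   ≡⟨ cong₂ _+_ (solve 1 (λ α → α := `1 :* α) refl α) (sym ⟨-z,a″⟩) ⟩
      1r * α + ⟨ (λ y → - z y) , a″ ⟩    ≡⟨ ⟨⟩-insertAt j (λ y → - z y) a″ 1r α ⟨
      ⟨ u , a ⟩                          ≡⟨ ⟨u,a⟩≡0 ⟩
      0r                                 ∎)
      where
      ⟨-z,a″⟩ : ⟨ (λ y → - z y) , a″ ⟩ ≡ - ⟨ a″ , z ⟩
      ⟨-z,a″⟩ = trans (⟨⟩-comm (λ y → - z y) a″) (⟨⟩-negʳ a″ z)
    A : Matrix ℝ (suc (suc m))
    A = border i B a 0r
    A∈S : InS ℝ G A
    A∈S = border-InS G i 0r B∈S a-pattern
    A-inj : Injective A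
    A-inj = border-injective-corank1 i B a 0r u (proj₁ B∈S) u∈ker kernel⊆span-nullVector ⟨u,a⟩≢0

proposition4p2 : (ℝ : RealField) {m : ℕ} (G : Graph (suc m)) (i : Fin (suc m)) →
    NotIsolated G i → AllowsSNIP ℝ G i 0 1
proposition4p2 ℝ {zero}  G zero (zero , 0~0) with trans (sym 0~0) (irrefl G zero)
... | ()
proposition4p2 ℝ {suc m} G i (j , i~j) =
  allows-0-1 ℝ G i (punchOut i≢j) (subst (λ k → adj G i k ≡ true) (sym (punchIn-punchOut i≢j)) i~j)
  where
  i≢j : ¬ i ≡ j
  i≢j refl with trans (sym i~j) (irrefl G i)
  ... | ()
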